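{- For all integers $m,n\ge 1$, every edge 2-coloring of the complete bipartite graph $K_{m,n}$ has a color group of size at least $\left\lceil \frac{mn}{4}\right\rceil$; that is, $\mathrm{OPT}(K_{m,n})\ge \left\lceil\frac14|E(K_{m,n})|\right\rceil=\left\lceil \frac{mn}{4}\right\rceil$.
   Context: An edge 2-coloring of a graph is an assignment of colors to its edges such that each vertex is incident to edges of at most 2 distinct colors. A color group is the set of all edges receiving a given color. $\mathrm{OPT}(G)$ denotes the minimum, over all edge 2-colorings of $G$, of the size of the largest color group. -}

module Defs where

open import Data.Nat using (ℕ; zero; suc; _+_; _*_)
open import Data.Nat.DivMod using (_/_)
open import Data.Fin using (Fin)
open import Data.Product using (_×_; ∃₂)
open import Data.Sum using (_⊎_)
open import Data.Bool using (if_then_else_)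
open import Relation.Nullary.Decidable using (⌊_⌋)
open import Relation.Binary.PropositionalEquality using (_≡_)
import Data.Nat as ℕ

Σ[<] : (n : ℕ) → (Fin n → ℕ) → ℕ
Σ[<] zero    f = 0
Σ[<] (suc n) f = f Fin.zero + Σ[<] n (λ i → f (Fin.suc i))

-- Edge colourings of K_{m,n}: edge (i,j), i a left vertex, j a right vertex,
-- gets colour c i j.  Colours are drawn from ℕ (an arbitrary colour set).
EdgeColouring : ℕ → ℕ → Set
EdgeColouring m n = Fin m → Fin n → ℕ

Is2Colouring : ∀ {m n} → EdgeColouring m n → Set
Is2Colouring {m} {n} c =
  ((i : Fin m) → ∃₂ λ a b → (j : Fin n) → (c i j ≡ a) ⊎ (c i j ≡ b)) ×
  ((j : Fin n) → ∃₂ λ a b → (i : Fin m) → (c i j ≡ a) ⊎ (c i j ≡ b))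

groupSize : ∀ {m n} → EdgeColouring m n → ℕ → ℕ
groupSize {m} {n} c k =
  Σ[<] m (λ i → Σ[<] n (λ j → if ⌊ c i j ℕ.≟ k ⌋ then 1 else 0))

⌈_/4⌉ : ℕ → ℕ
⌈ x /4⌉ = (x + 3) / 4

-- Let e_z be the size of the colour class of z, and r_z (resp. q_z) the number of rows (resp.
-- columns) whose palette of at most two colours contains z.  The class of z lies in those rows
-- and columns, so e_z ≤ r_z q_z, while Σ_z r_z ≤ 2m and Σ_z q_z ≤ 2n.  If every class had
-- 4 e_z < mn, then by AM-GM (n r_z + m q_z)² ≥ 4mn r_z q_z > 16 e_z², so 4 e_z < n r_z + m q_z
-- for every colour in use, and summing over the colours gives 4mn < 2mn + 2mn.
module Submission where

open import Defs
open import Data.Nat using (ℕ; zero; suc; _+_; _*_; _≤_; _<_; _≟_; _≤?_; z≤n; s≤s; s≤s⁻¹)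
open import Data.Nat.Properties
open import Data.Nat.DivMod using (m<n*o⇒m/o<n)
open import Data.Nat.Tactic.RingSolver using (solve-∀)
open import Data.Fin using (Fin; toℕ; fromℕ<)
open import Data.Fin.Properties using (toℕ-fromℕ<; any?)
open import Data.Product using (∃; _×_; _,_; proj₁; proj₂)
open import Data.Sum using (_⊎_; inj₁; inj₂)
open import Data.Bool using (if_then_else_)
open import Data.Empty using (⊥-elim)
open import Function using (_∘_; case_of_)
open import Relation.Nullary using (¬_; yes; no; contradiction)
open import Relation.Nullary.Decidable using (⌊_⌋)
open import Relation.Binary.PropositionalEquality
open import Algebra.Properties.Semiring.Sum +-*-semiring
  using (sum; sum-syntax; sum-cong-≗; sum-replicate-zero; ∑-comm; ∑-distrib-+;
         *-distribˡ-sum; *-distribʳ-sum)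

Σ[<]≡sum : ∀ n (f : Fin n → ℕ) → Σ[<] n f ≡ sum f
Σ[<]≡sum zero    f = refl
Σ[<]≡sum (suc n) f = cong (f Fin.zero +_) (Σ[<]≡sum n (f ∘ Fin.suc))

sum-const : ∀ n x → ∑[ i < n ] x ≡ n * x
sum-const zero    x = refl
sum-const (suc n) x = cong (x +_) (sum-const n x)

sum-mono-≤ : ∀ {n} {f g : Fin n → ℕ} → (∀ i → f i ≤ g i) → sum f ≤ sum g
sum-mono-≤ {zero}  f≤g = z≤n
sum-mono-≤ {suc n} f≤g = +-mono-≤ (f≤g Fin.zero) (sum-mono-≤ (f≤g ∘ Fin.suc))

sum-mono-< : ∀ {n} {f g : Fin n → ℕ} → (∀ i → f i ≤ g i) → ∀ i → f i < g i → sum f < sum g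
sum-mono-< f≤g Fin.zero    fi<gi = +-mono-<-≤ fi<gi (sum-mono-≤ (f≤g ∘ Fin.suc))
sum-mono-< f≤g (Fin.suc i) fi<gi = +-mono-≤-< (f≤g Fin.zero) (sum-mono-< (f≤g ∘ Fin.suc) i fi<gi)

≤-sum : ∀ {n} (f : Fin n → ℕ) i → f i ≤ sum f
≤-sum f Fin.zero    = m≤m+n _ _
≤-sum f (Fin.suc i) = ≤-trans (≤-sum (f ∘ Fin.suc) i) (m≤n+m _ _)

δ : ℕ → ℕ → ℕ
δ x z = if ⌊ x ≟ z ⌋ then 1 else 0

δ-refl : ∀ x → δ x x ≡ 1
δ-refl x with x ≟ x
... | yes _    = refl
... | no  x≢x  = contradiction refl x≢x

δ-≢ : ∀ {x z} → x ≢ z → δ x z ≡ 0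
δ-≢ {x} {z} x≢z with x ≟ z
... | yes x≡z = contradiction x≡z x≢z
... | no  _   = refl

δ-idem : ∀ x z → δ x z * δ x z ≡ δ x z
δ-idem x z with x ≟ z
... | yes _ = refl
... | no  _ = refl

δ-suc : ∀ x z → δ (suc x) (suc z) ≡ δ x z
δ-suc x z = case x ≟ z of λ where
  (yes refl) → trans (δ-refl (suc x)) (sym (δ-refl x))
  (no x≢z)   → trans (δ-≢ (x≢z ∘ suc-injective)) (sym (δ-≢ x≢z))

∑-δ-suc : ∀ B x → ∑[ z < suc B ] δ (suc x) (toℕ z) ≡ ∑[ z < B ] δ x (toℕ z)
∑-δ-suc B x = cong (δ (suc x) 0 +_) (sum-cong-≗ {B} (λ z → δ-suc x (toℕ z)))

∑-δ-zero : ∀ B → ∑[ z < suc B ] δ 0 (toℕ z) ≡ 1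
∑-δ-zero B = cong suc (sum-replicate-zero B)

∑-δ≤1 : ∀ B x → ∑[ z < B ] δ x (toℕ z) ≤ 1
∑-δ≤1 zero    x       = z≤n
∑-δ≤1 (suc B) zero    = ≤-reflexive (∑-δ-zero B)
∑-δ≤1 (suc B) (suc x) = ≤-trans (≤-reflexive (∑-δ-suc B x)) (∑-δ≤1 B x)

∑-δ≡1 : ∀ {B x} → x < B → ∑[ z < B ] δ x (toℕ z) ≡ 1
∑-δ≡1 {suc B} {zero}  _         = ∑-δ-zero B
∑-δ≡1 {suc B} {suc x} (s≤s x<B) = trans (∑-δ-suc B x) (∑-δ≡1 x<B)

groupSize≡∑∑δ : ∀ {m n} (c : EdgeColouring m n) z →
  groupSize c z ≡ ∑[ i < m ] ∑[ j < n ] δ (c i j) z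
groupSize≡∑∑δ {m} {n} c z =
  trans (Σ[<]≡sum m _) (sum-cong-≗ (λ i → Σ[<]≡sum n (λ j → δ (c i j) z)))

colourBound : ∀ {m n} → EdgeColouring m n → ℕ
colourBound {m} {n} c = suc (∑[ i < m ] ∑[ j < n ] c i j)

colour<colourBound : ∀ {m n} (c : EdgeColouring m n) i j → c i j < colourBound c
colour<colourBound c i j = s≤s (≤-trans (≤-sum (c i) j) (≤-sum (λ i → sum (c i)) i))

∑-groupSize : ∀ {m n} (c : EdgeColouring m n) {B} → (∀ i j → c i j < B) →
  ∑[ z < B ] groupSize c (toℕ z) ≡ m * n
∑-groupSize {m} {n} c {B} c<B = begin
  ∑[ z < B ] groupSize c (toℕ z)
    ≡⟨ sum-cong-≗ {B} (groupSize≡∑∑δ c ∘ toℕ) ⟩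
  ∑[ z < B ] ∑[ i < m ] ∑[ j < n ] δ (c i j) (toℕ z)
    ≡⟨ ∑-comm {B} {m} (λ z i → ∑[ j < n ] δ (c i j) (toℕ z)) ⟩
  ∑[ i < m ] ∑[ z < B ] ∑[ j < n ] δ (c i j) (toℕ z)
    ≡⟨ sum-cong-≗ {m} (λ i → ∑-comm {B} {n} (λ z j → δ (c i j) (toℕ z))) ⟩
  ∑[ i < m ] ∑[ j < n ] ∑[ z < B ] δ (c i j) (toℕ z)
    ≡⟨ sum-cong-≗ {m} (λ i → sum-cong-≗ {n} (λ j → ∑-δ≡1 (c<B i j))) ⟩
  ∑[ i < m ] ∑[ j < n ] 1
    ≡⟨ sum-cong-≗ {m} (λ i → trans (sum-const n 1) (*-identityʳ n)) ⟩
  ∑[ i < m ] n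
    ≡⟨ sum-const m n ⟩
  m * n
    ∎
  where open ≡-Reasoning

Palette : Set
Palette = ℕ × ℕ

_∈ₚ_ : ℕ → Palette → Set
x ∈ₚ (a , b) = x ≡ a ⊎ x ≡ b

multiplicity : Palette → ℕ → ℕ
multiplicity (a , b) z = δ a z + δ b z

δ≤multiplicity : ∀ {x p} z → x ∈ₚ p → δ x z ≤ multiplicity p z
δ≤multiplicity z (inj₁ refl) = m≤m+n _ _
δ≤multiplicity z (inj₂ refl) = m≤n+m _ _

∑-multiplicity≤2 : ∀ B p → ∑[ z < B ] multiplicity p (toℕ z) ≤ 2
∑-multiplicity≤2 B (a , b) = begin
  ∑[ z < B ] (δ a (toℕ z) + δ b (toℕ z))            ≡⟨ ∑-distrib-+ {B} (δ a ∘ toℕ) (δ b ∘ toℕ) ⟩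
  ∑[ z < B ] δ a (toℕ z) + ∑[ z < B ] δ b (toℕ z)  ≤⟨ +-mono-≤ (∑-δ≤1 B a) (∑-δ≤1 B b) ⟩
  2                                                ∎
  where open ≤-Reasoning

palettesWith : ∀ {k} → (Fin k → Palette) → ℕ → ℕ
palettesWith {k} P z = ∑[ i < k ] multiplicity (P i) z

∑-palettesWith≤ : ∀ B {k} (P : Fin k → Palette) → ∑[ z < B ] palettesWith P (toℕ z) ≤ k * 2
∑-palettesWith≤ B {k} P = begin
  ∑[ z < B ] ∑[ i < k ] multiplicity (P i) (toℕ z)
    ≡⟨ ∑-comm {B} {k} (λ z i → multiplicity (P i) (toℕ z)) ⟩
  ∑[ i < k ] ∑[ z < B ] multiplicity (P i) (toℕ z)
    ≤⟨ sum-mono-≤ (λ i → ∑-multiplicity≤2 B (P i)) ⟩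
  ∑[ i < k ] 2
    ≡⟨ sum-const k 2 ⟩
  k * 2
    ∎
  where open ≤-Reasoning

groupSize≤palettesWith* : ∀ {m n} (c : EdgeColouring m n) →
  (row : Fin m → Palette) (col : Fin n → Palette) →
  (∀ i j → c i j ∈ₚ row i) → (∀ i j → c i j ∈ₚ col j) →
  ∀ z → groupSize c z ≤ palettesWith row z * palettesWith col z
groupSize≤palettesWith* {m} {n} c row col c∈row c∈col z = begin
  groupSize c z
    ≡⟨ groupSize≡∑∑δ c z ⟩
  ∑[ i < m ] ∑[ j < n ] δ (c i j) z
    ≡⟨ sum-cong-≗ {m} (λ i → sum-cong-≗ {n} (λ j → sym (δ-idem (c i j) z))) ⟩
  ∑[ i < m ] ∑[ j < n ] (δ (c i j) z * δ (c i j) z)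
    ≤⟨ sum-mono-≤ (λ i → sum-mono-≤ (λ j → *-mono-≤ (δ≤multiplicity z (c∈row i j))
                                                    (δ≤multiplicity z (c∈col i j)))) ⟩
  ∑[ i < m ] ∑[ j < n ] (multiplicity (row i) z * multiplicity (col j) z)
    ≡⟨ sum-cong-≗ {m} (λ i → sym (*-distribˡ-sum (multiplicity (row i) z)
                                                   (λ j → multiplicity (col j) z))) ⟩
  ∑[ i < m ] (multiplicity (row i) z * palettesWith col z)
    ≡⟨ sym (*-distribʳ-sum (palettesWith col z) (λ i → multiplicity (row i) z)) ⟩
  palettesWith row z * palettesWith col z
    ∎
  where open ≤-Reasoning

groupSize-colour≥1 : ∀ {m n} (c : EdgeColouring m n) i j → 1 ≤ groupSize c (c i j)
groupSize-colour≥1 c i j = begin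
  1                                           ≡⟨ sym (δ-refl (c i j)) ⟩
  δ (c i j) (c i j)                           ≤⟨ ≤-sum (λ j′ → δ (c i j′) (c i j)) j ⟩
  ∑[ j′ < _ ] δ (c i j′) (c i j)              ≤⟨ ≤-sum (λ i′ → ∑[ j′ < _ ] δ (c i′ j′) (c i j)) i ⟩
  ∑[ i′ < _ ] ∑[ j′ < _ ] δ (c i′ j′) (c i j) ≡⟨ sym (groupSize≡∑∑δ c (c i j)) ⟩
  groupSize c (c i j)                         ∎
  where open ≤-Reasoning

4x[x+d]≤[2x+d]² : ∀ x d → 4 * (x * (x + d)) ≤ (x + (x + d)) * (x + (x + d))
4x[x+d]≤[2x+d]² x d = ≤-trans (m≤m+n _ (d * d)) (≤-reflexive (square-of-sum x d))
  where
  square-of-sum : ∀ x d → 4 * (x * (x + d)) + d * d ≡ (x + (x + d)) * (x + (x + d))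
  square-of-sum = solve-∀

4xy≤[x+y]² : ∀ x y → 4 * (x * y) ≤ (x + y) * (x + y)
4xy≤[x+y]² x y with ≤-total x y
... | inj₁ x≤y with d , refl ← m≤n⇒∃[o]m+o≡n x≤y = 4x[x+d]≤[2x+d]² x d
... | inj₂ y≤x with d , refl ← m≤n⇒∃[o]m+o≡n y≤x =
  subst₂ _≤_ (cong (4 *_) (*-comm y (y + d))) (cong (λ s → s * s) (+-comm y (y + d)))
    (4x[x+d]≤[2x+d]² y d)

m*m≤n*n⇒m≤n : ∀ {m n} → m * m ≤ n * n → m ≤ n
m*m≤n*n⇒m≤n m*m≤n*n = ≮⇒≥ (λ n<m → <⇒≱ (*-mono-< n<m n<m) m*m≤n*n)

m*m<n*n⇒m<n : ∀ {m n} → m * m < n * n → m < n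
m*m<n*n⇒m<n m*m<n*n = ≰⇒> (λ n≤m → <⇒≱ m*m<n*n (*-mono-≤ n≤m n≤m))

[4e]²+4rq≤[nr+mq]² : ∀ m n {e} r q → 4 * e < m * n → e ≤ r * q →
  4 * e * (4 * e) + 4 * (r * q) ≤ (n * r + m * q) * (n * r + m * q)
[4e]²+4rq≤[nr+mq]² m n {e} r q 4e<mn e≤rq = begin
  4 * e * (4 * e) + 4 * (r * q)              ≤⟨ +-monoˡ-≤ _ (*-monoʳ-≤ (4 * e) (*-monoʳ-≤ 4 e≤rq)) ⟩
  4 * e * (4 * (r * q)) + 4 * (r * q)        ≡⟨ +-comm (4 * e * (4 * (r * q))) (4 * (r * q)) ⟩
  suc (4 * e) * (4 * (r * q))                ≤⟨ *-monoˡ-≤ _ 4e<mn ⟩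
  m * n * (4 * (r * q))                      ≡⟨ regroup m n r q ⟩
  4 * ((n * r) * (m * q))                    ≤⟨ 4xy≤[x+y]² (n * r) (m * q) ⟩
  (n * r + m * q) * (n * r + m * q)          ∎
  where
  open ≤-Reasoning
  regroup : ∀ m n r q → m * n * (4 * (r * q)) ≡ 4 * ((n * r) * (m * q))
  regroup = solve-∀

4e≤nr+mq : ∀ m n {e} r q → 4 * e < m * n → e ≤ r * q → 4 * e ≤ n * r + m * q
4e≤nr+mq m n r q 4e<mn e≤rq =
  m*m≤n*n⇒m≤n (≤-trans (m≤m+n _ _) ([4e]²+4rq≤[nr+mq]² m n r q 4e<mn e≤rq))

4e<nr+mq : ∀ m n {e} r q → 4 * e < m * n → e ≤ r * q → 1 ≤ e → 4 * e < n * r + m * q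
4e<nr+mq m n r q 4e<mn e≤rq 1≤e = m*m<n*n⇒m<n
  (<-≤-trans (m<m+n _ 0<4rq) ([4e]²+4rq≤[nr+mq]² m n r q 4e<mn e≤rq))
  where
  0<4rq : 0 < 4 * (r * q)
  0<4rq = ≤-trans (≤-trans 1≤e e≤rq) (m≤n*m (r * q) 4)

x≤4y⇒⌈x/4⌉≤y : ∀ {x y} → x ≤ 4 * y → ⌈ x /4⌉ ≤ y
x≤4y⇒⌈x/4⌉≤y {x} {y} x≤4y = s≤s⁻¹ (m<n*o⇒m/o<n (begin-strict
  x + 3           ≤⟨ +-monoˡ-≤ 3 x≤4y ⟩
  4 * y + 3       <⟨ n<1+n _ ⟩
  suc (4 * y + 3) ≡⟨ four-times-suc y ⟩
  suc y * 4       ∎))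
  where
  open ≤-Reasoning
  four-times-suc : ∀ y → suc (4 * y + 3) ≡ suc y * 4
  four-times-suc = solve-∀

module _ {m n : ℕ} {c : EdgeColouring m n} (c-2col : Is2Colouring c) where

  rowPalette : Fin m → Palette
  rowPalette i = proj₁ (proj₁ c-2col i) , proj₁ (proj₂ (proj₁ c-2col i))

  colPalette : Fin n → Palette
  colPalette j = proj₁ (proj₂ c-2col j) , proj₁ (proj₂ (proj₂ c-2col j))

  c∈rowPalette : ∀ i j → c i j ∈ₚ rowPalette i
  c∈rowPalette i j = proj₂ (proj₂ (proj₁ c-2col i)) j

  c∈colPalette : ∀ i j → c i j ∈ₚ colPalette j
  c∈colPalette i j = proj₂ (proj₂ (proj₂ c-2col j)) i

  ¬all-groupSizes<mn/4 : Fin m → Fin n →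
    ¬ (∀ (z : Fin (colourBound c)) → 4 * groupSize c (toℕ z) < m * n)
  ¬all-groupSizes<mn/4 i₀ j₀ small = <-irrefl refl (begin-strict
    4 * (m * n)
      ≡⟨ cong (4 *_) (sym (∑-groupSize c (colour<colourBound c))) ⟩
    4 * ∑[ z < B ] e z
      ≡⟨ *-distribˡ-sum 4 e ⟩
    ∑[ z < B ] (4 * e z)
      <⟨ sum-mono-< (λ z → 4e≤nr+mq m n (r z) (q z) (small z) (e≤rq z)) z₀ 4e₀<nr₀+mq₀ ⟩
    ∑[ z < B ] (n * r z + m * q z)
      ≡⟨ ∑-distrib-+ {B} (λ z → n * r z) (λ z → m * q z) ⟩
    ∑[ z < B ] (n * r z) + ∑[ z < B ] (m * q z)
      ≡⟨ sym (cong₂ _+_ (*-distribˡ-sum n r) (*-distribˡ-sum m q)) ⟩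
    n * ∑[ z < B ] r z + m * ∑[ z < B ] q z
      ≤⟨ +-mono-≤ (*-monoʳ-≤ n (∑-palettesWith≤ B rowPalette))
                  (*-monoʳ-≤ m (∑-palettesWith≤ B colPalette)) ⟩
    n * (m * 2) + m * (n * 2)
      ≡⟨ double-count m n ⟩
    4 * (m * n)
      ∎)
    where
    open ≤-Reasoning
    B = colourBound c
    e r q : Fin B → ℕ
    e z = groupSize c (toℕ z)
    r z = palettesWith rowPalette (toℕ z)
    q z = palettesWith colPalette (toℕ z)
    e≤rq : ∀ z → e z ≤ r z * q z
    e≤rq z = groupSize≤palettesWith* c rowPalette colPalette c∈rowPalette c∈colPalette (toℕ z)
    z₀ : Fin B
    z₀ = fromℕ< (colour<colourBound c i₀ j₀)
    1≤e₀ : 1 ≤ e z₀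
    1≤e₀ = subst (λ z → 1 ≤ groupSize c z) (sym (toℕ-fromℕ< _)) (groupSize-colour≥1 c i₀ j₀)
    4e₀<nr₀+mq₀ : 4 * e z₀ < n * r z₀ + m * q z₀
    4e₀<nr₀+mq₀ = 4e<nr+mq m n (r z₀) (q z₀) (small z₀) (e≤rq z₀) 1≤e₀
    double-count : ∀ m n → n * (m * 2) + m * (n * 2) ≡ 4 * (m * n)
    double-count = solve-∀

theorem5 : (m n : ℕ) → 1 ≤ m → 1 ≤ n → (c : EdgeColouring m n) → Is2Colouring c →
    ∃ λ k → ⌈ m * n /4⌉ ≤ groupSize c k
theorem5 m n 1≤m 1≤n c c-2col
  with any? (λ (z : Fin (colourBound c)) → ⌈ m * n /4⌉ ≤? groupSize c (toℕ z))
... | yes (z , large) = toℕ z , large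
... | no  noneLarge   = ⊥-elim (¬all-groupSizes<mn/4 c-2col (fromℕ< 1≤m) (fromℕ< 1≤n)
        (λ z → ≰⇒> (noneLarge ∘ (z ,_) ∘ x≤4y⇒⌈x/4⌉≤y)))
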